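{- Fix an integer $m>1$ and let $SF(n,m)$ be the set of semi-$m$-Fibonacci partitions of $n$ (defined in the context). Let $n\ge 1$ and $\lambda\in SF(n,m)$. If $m\mid n$, then every part of $\lambda$ is a multiple of $m$. If $n\equiv r\pmod m$ with $1\le r<m$, then $\lambda$ contains exactly one part congruent to $r$ modulo $m$.
   Context: For fixed $m>1$, the sets $SF(n,m)$ of partitions of $n$ ($n\ge1$) are defined recursively: $SF(n,m)=\{(n)\}$ for $n=1,\dots,m$. If $n>m$ and $m\mid n$, then $SF(n,m)$ consists of the partitions obtained from the partitions in $SF(n/m,m)$ by multiplying every part by $m$. If $n>m$ and $n\equiv r\pmod m$ with $1\le r\le m-1$, then $SF(n,m)$ consists of (a) the partitions obtained by inserting a part $r$ into a partition of $SF(n-r,m)$, together with (b) the partitions obtained from a partition $\lambda\in SF(n-m,m)$ by adding $m$ to the single part of $\lambda$ that is congruent to $r$ modulo $m$. -}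

module Defs where

open import Data.Nat using (ℕ; _+_; _*_; _∸_; _≤_; _<_)
open import Data.Nat.Divisibility using (_∣_)
open import Data.List using (List; []; _∷_; map)
open import Data.List.Relation.Unary.All using (All)
open import Data.List.Relation.Binary.Permutation.Propositional using (_↭_)
open import Data.Product using (∃; ∃-syntax; _×_)
open import Relation.Binary.PropositionalEquality using (_≡_)
open import Relation.Nullary using (¬_)

-- x is congruent to r modulo m (used with r < m): x = q * m + r.
_≡_[mod_] : ℕ → ℕ → ℕ → Set
x ≡ r [mod m ] = ∃[ q ] (x ≡ q * m + r)

-- Partitions are represented by lists of parts, identified up to
-- permutation (every constructor closes under _↭_).
-- SF m n lam : λ is a semi-m-Fibonacci partition of n.
data SF (m : ℕ) : ℕ → List ℕ → Set where
  base : ∀ {n} → 1 ≤ n → n ≤ m → SF m n (n ∷ [])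
  mult : ∀ {n k μ lam} → m < n → n ≡ m * k → SF m k μ →
         lam ↭ map (m *_) μ → SF m n lam
  ins  : ∀ {n r μ lam} → m < n → 1 ≤ r → r < m → n ≡ r [mod m ] →
         SF m (n ∸ r) μ → lam ↭ r ∷ μ → SF m n lam
  add  : ∀ {n r μ ν a lam} → m < n → 1 ≤ r → r < m → n ≡ r [mod m ] →
         SF m (n ∸ m) μ → μ ↭ a ∷ ν → a ≡ r [mod m ] →
         lam ↭ (a + m) ∷ ν → SF m n lam

ExactlyOneCong : ℕ → ℕ → List ℕ → Set
ExactlyOneCong m r lam =
  ∃[ a ] ∃[ ν ] (lam ↭ a ∷ ν × a ≡ r [mod m ] × All (λ x → ¬ (x ≡ r [mod m ])) ν)

-- Strengthen the claim: when n ≡ r (mod m), one part of λ is ≡ r (mod m) and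
-- all others are multiples of m. The divisible case follows directly from the
-- rules, since the rules inserting or enlarging a part ≡ r only apply when
-- m ∤ n. The strengthened claim then survives adding m to the part a ≡ r:
-- every other part of the old partition is a multiple of m, so a is its unique
-- part ≡ r and the remaining parts are still multiples of m.

module Submission where

open import Defs
open import Data.Nat using (ℕ; zero; suc; _+_; _*_; _∸_; _≤_; _<_; NonZero; _%_)
open import Data.Nat.Properties
open import Data.Nat.DivMod using ([m+kn]%n≡m%n; m<n⇒m%n≡m)
open import Data.Nat.Divisibility using (_∣_; divides; m∣m*n; n∣m⇒m%n≡0)
open import Data.List using (List; []; _∷_)
open import Data.List.Relation.Unary.All as All using (All; []; _∷_)
open import Data.List.Relation.Unary.All.Properties using (map⁺)
open import Data.List.Relation.Unary.Any using (here; there)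
open import Data.List.Relation.Binary.Permutation.Propositional using (_↭_; ↭-refl; ↭-sym; ↭-trans)
open import Data.List.Relation.Binary.Permutation.Propositional.Properties using (∈-resp-↭; drop-∷; All-resp-↭)
open import Data.Product using (_×_; ∃-syntax; _,_)
open import Relation.Nullary using (¬_; contradiction)
open import Relation.Binary.PropositionalEquality using (_≡_; refl; sym; trans; cong; module ≡-Reasoning)

≡[mod]⇒%≡ : ∀ {m x r} .{{_ : NonZero m}} → r < m → x ≡ r [mod m ] → x % m ≡ r
≡[mod]⇒%≡ {m} {r = r} r<m (q , refl) = begin
  (q * m + r) % m ≡⟨ cong (_% m) (+-comm (q * m) r) ⟩
  (r + q * m) % m ≡⟨ [m+kn]%n≡m%n r q m ⟩
  r % m           ≡⟨ m<n⇒m%n≡m r<m ⟩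
  r               ∎
  where open ≡-Reasoning

≡[mod]-unique : ∀ {m x r s} .{{_ : NonZero m}} → r < m → s < m →
                x ≡ r [mod m ] → x ≡ s [mod m ] → r ≡ s
≡[mod]-unique r<m s<m x≡r x≡s =
  trans (sym (≡[mod]⇒%≡ r<m x≡r)) (≡[mod]⇒%≡ s<m x≡s)

∣⇒≢[mod] : ∀ {m x r} .{{_ : NonZero m}} → 1 ≤ r → r < m →
           m ∣ x → ¬ (x ≡ r [mod m ])
∣⇒≢[mod] {m} {x} 1≤r r<m m∣x x≡r =
  <⇒≢ 1≤r (trans (sym (n∣m⇒m%n≡0 x m m∣x)) (≡[mod]⇒%≡ r<m x≡r))

≡[mod]⇒∣∸ : ∀ {m n r} → n ≡ r [mod m ] → m ∣ n ∸ r
≡[mod]⇒∣∸ {m} {r = r} (q , refl) = divides q (m+n∸n≡m (q * m) r)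

∸-≡[mod] : ∀ {m n r} → r < m → m < n → n ≡ r [mod m ] → (n ∸ m) ≡ r [mod m ]
∸-≡[mod]         r<m m<n (zero  , refl) = contradiction m<n (<⇒≯ r<m)
∸-≡[mod] {m} {r = r} _ _ (suc q , refl) = q , (begin
  m + q * m + r ∸ m   ≡⟨ cong (_∸ m) (+-assoc m (q * m) r) ⟩
  m + (q * m + r) ∸ m ≡⟨ m+n∸m≡n m (q * m + r) ⟩
  q * m + r           ∎)
  where open ≡-Reasoning

+-≡[mod] : ∀ {m a r} → a ≡ r [mod m ] → (a + m) ≡ r [mod m ]
+-≡[mod] {m} {r = r} (q , refl) = suc q , (begin
  q * m + r + m   ≡⟨ +-assoc (q * m) r m ⟩
  q * m + (r + m) ≡⟨ cong (q * m +_) (+-comm r m) ⟩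
  q * m + (m + r) ≡⟨ sym (+-assoc (q * m) m r) ⟩
  q * m + m + r   ≡⟨ cong (_+ r) (+-comm (q * m) m) ⟩
  m + q * m + r   ∎)
  where open ≡-Reasoning

All-drop-↭ : ∀ {A : Set} {P : A → Set} {a a′ : A} {ν ν′ : List A} →
             ¬ P a → a ∷ ν ↭ a′ ∷ ν′ → All P ν′ → All P ν
All-drop-↭ ¬Pa p Pν′ with ∈-resp-↭ p (here refl)
... | here refl = All-resp-↭ (↭-sym (drop-∷ p)) Pν′
... | there a∈ν′ = contradiction (All.lookup Pν′ a∈ν′) ¬Pa

CongPartAmongMultiples : ℕ → ℕ → List ℕ → Set
CongPartAmongMultiples m r lam =
  ∃[ a ] ∃[ ν ] (lam ↭ a ∷ ν × a ≡ r [mod m ] × All (m ∣_) ν)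

SF-multiples : ∀ {m n lam} .{{_ : NonZero m}} → SF m n lam → m ∣ n → All (m ∣_) lam
SF-multiples (base _ _)              m∣n = m∣n ∷ []
SF-multiples (mult {μ = μ} _ _ _ p)  _   =
  All-resp-↭ (↭-sym p) (map⁺ (All.universal m∣m*n μ))
SF-multiples (ins _ 1≤r r<m n≡r _ _) m∣n = contradiction n≡r (∣⇒≢[mod] 1≤r r<m m∣n)
SF-multiples (add _ 1≤r r<m n≡r _ _ _ _) m∣n = contradiction n≡r (∣⇒≢[mod] 1≤r r<m m∣n)

SF-congPart : ∀ {m n lam r} .{{_ : NonZero m}} → SF m n lam →
              1 ≤ r → r < m → n ≡ r [mod m ] → CongPartAmongMultiples m r lam
SF-congPart {n = n} (base _ _) _ _ n≡r = n , [] , ↭-refl , n≡r , []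
SF-congPart {m} (mult {k = k} _ refl _ _) 1≤r r<m n≡r =
  contradiction n≡r (∣⇒≢[mod] 1≤r r<m (m∣m*n k))
SF-congPart (ins {r = r₀} {μ} _ _ r₀<m n≡r₀ sf p) _ r<m n≡r
  with refl ← ≡[mod]-unique r₀<m r<m n≡r₀ n≡r =
  r₀ , μ , p , (0 , refl) , SF-multiples sf (≡[mod]⇒∣∸ n≡r₀)
SF-congPart {m} (add {r = r₀} {a = a} m<n 1≤r₀ r₀<m n≡r₀ sf μ↭aν a≡r₀ p) _ r<m n≡r
  with refl ← ≡[mod]-unique r₀<m r<m n≡r₀ n≡r
  with a′ , ν′ , μ↭a′ν′ , _ , m∣ν′ ← SF-congPart sf 1≤r₀ r₀<m (∸-≡[mod] r₀<m m<n n≡r₀) =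
  a + m , _ , p , +-≡[mod] a≡r₀ ,
  All-drop-↭ (λ m∣a → ∣⇒≢[mod] 1≤r₀ r₀<m m∣a a≡r₀) (↭-trans (↭-sym μ↭aν) μ↭a′ν′) m∣ν′

lemma1 : (m : ℕ) → 1 < m → (n : ℕ) → 1 ≤ n → (λ′ : List ℕ) → SF m n λ′ →
         (m ∣ n → All (m ∣_) λ′) ×
         ((r : ℕ) → 1 ≤ r → r < m → n ≡ r [mod m ] → ExactlyOneCong m r λ′)
lemma1 m@(suc _) _ n _ λ′ sf = SF-multiples sf , exactlyOne
  where
  exactlyOne : (r : ℕ) → 1 ≤ r → r < m → n ≡ r [mod m ] → ExactlyOneCong m r λ′
  exactlyOne r 1≤r r<m n≡r with a , ν , p , a≡r , m∣ν ← SF-congPart sf 1≤r r<m n≡r =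
    a , ν , p , a≡r , All.map (∣⇒≢[mod] 1≤r r<m) m∣ν
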